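{- Let $\Theta$ be an open saturated branch of a tableau of $\mathbf{TAB}_{\mathbf{IB}}$, let $\mathcal{M}^\Theta=(W^\Theta,R^\Theta,V^\Theta)$ be its model, and let $W^\Theta_r=\{w\in W^\Theta\mid wR^\Theta w\}$. If $i\in W^\Theta_r$, then $i$ is not named by the root formula of $\Theta$, i.e. there is no nominal $j$ with $j\in T^\Theta(i)$.
   Context: Hybrid language: fix disjoint countably infinite sets $\mathbf{Prop}$ (propositional variables) and $\mathbf{Nom}$ (nominals). Formulas: $\varphi ::= p \mid i \mid \neg\varphi \mid \varphi\land\varphi \mid \diamondsuit\varphi \mid @_i\varphi$ with $p\in\mathbf{Prop}$, $i\in\mathbf{Nom}$; $\square\varphi$ abbreviates $\neg\diamondsuit\neg\varphi$. A model is $(W,R,V)$ with $W\neq\emptyset$, $R\subseteq W\times W$, $V:\mathbf{Prop}\cup\mathbf{Nom}\to\mathcal{P}(W)$ with $V(i)$ a singleton for each nominal $i$. Tableaux of $\mathbf{TAB}_{\mathbf{IB}}$: a tableau is a well-founded tree of formulas of the form $@_i\varphi$, started from a root formula $@_i\varphi$ where $i$ does not occur in $\varphi$. Each branch (maximal path) is extended by applying the rules below as often as possible, except that nothing more is added to a branch once it is closed, or once every formula that any rule could generate already occurs on it. A branch $\Theta$ is closed if $@_i\varphi, @_i\neg\varphi\in\Theta$ for some $i,\varphi$, open otherwise, and saturated if every formula that any rule could generate from it already occurs in $\Theta$. Rules (premises already on the branch, conclusions added to it): [$\neg\neg$] from $@_i\neg\neg\varphi$ add $@_i\varphi$; [$\land$]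 from $@_i(\varphi\land\psi)$ add $@_i\varphi$ and $@_i\psi$; [$\neg\land$] from $@_i\neg(\varphi\land\psi)$ split the branch into one branch with $@_i\neg\varphi$ and one with $@_i\neg\psi$; [$\diamondsuit$] from $@_i\diamondsuit\varphi$ add $@_i\diamondsuit j$ and $@_j\varphi$, where $j$ is a nominal not yet occurring on the branch, the rule is applied at most once per formula, the premise is not an accessibility formula, and (restriction $\mathcal{D}$) $i$ is a quasi-urfather on the branch; [$\neg\diamondsuit$] from $@_i\neg\diamondsuit\varphi$ and $@_i\diamondsuit j$ add $@_j\neg\varphi$; [$@$] from $@_i@_j\varphi$ add $@_j\varphi$; [$\neg@$] from $@_i\neg@_j\varphi$ add $@_j\neg\varphi$; [$\mathit{Id}$] from $@_i\varphi$ and $@_i j$ add $@_j\varphi$, provided $@_i\varphi$ is not an accessibility formula; [$\mathit{Ref}$] add $@_i i$ for any nominal $i$ occurring on the branch; [$\square_{\mathit{sym}}$] from $@_i\square\varphi$ and $@_j\diamondsuit i$ add $@_j\varphi$; ($\mathcal{I}$) for every nominal $i$ occurring on the branch add $@_i\neg\diamondsuit i$. An accessibility formula is a formula $@_i\diamondsuit j$ added by [$\diamondsuit$] with $j$ new. Auxiliary notions for a branch $\Theta$: $@_i\varphi$ is a quasi-subformula of $@_j\psi$ if $\varphi$ is a subformula of $\psi$, or $\varphi=\neg\chi$ with $\chi$ a subformula of $\psi$. $T^\Theta(i)=\{\varphi \mid @_i\varphi\in\Theta$ and $@_i\varphi$ is a quasi-subformula of the root formula$\}$. Nominals $i,j$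 are twins in $\Theta$ if $T^\Theta(i)=T^\Theta(j)$. $i\prec_\Theta j$ if $j$ was introduced by applying [$\diamondsuit$] to a formula $@_i\diamondsuit\varphi$; $\prec_\Theta^*$ is its reflexive transitive closure. A nominal $i$ is a quasi-urfather on $\Theta$ if there are no twins $j\neq k$ with $j\prec_\Theta^* i$ and $k\prec_\Theta^* i$. The identity urfather $v_\Theta(i)$ of a nominal $i$ occurring in $\Theta$ is the earliest introduced nominal $j$ on $\Theta$ that is a twin of $i$ and a quasi-urfather on $\Theta$, if such $j$ exists; $\mathrm{dom}(v_\Theta)$ is the set of nominals $i$ for which $v_\Theta(i)$ exists; $i$ is called an identity urfather if $v_\Theta(i)=i$. The model $\mathcal{M}^\Theta=(W^\Theta,R^\Theta,V^\Theta)$ of an open saturated branch $\Theta$ with root formula $@_{i_0}\varphi_0$: $W^\Theta$ is the set of identity urfathers on $\Theta$; $R^\Theta=\{(v_\Theta(i),v_\Theta(j)) \mid @_i\diamondsuit j\in\Theta,\ i,j\in\mathrm{dom}(v_\Theta)\}\cup\{(v_\Theta(j),v_\Theta(i)) \mid @_i\diamondsuit j\in\Theta,\ i,j\in\mathrm{dom}(v_\Theta)\}$; $V^\Theta(p)=\{v_\Theta(i)\mid @_i p\in\Theta\}$ for $p\in\mathbf{Prop}$; for $i\in\mathbf{Nom}$, $V^\Theta(i)=\{v_\Theta(i)\}$ if $i\in\mathrm{dom}(v_\Theta)$ and $V^\Theta(i)=\{i_0\}$ otherwise. A world $i\in W^\Theta$ is named by the root formula of $\Theta$ if there is a nominal $j$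 with $j\in T^\Theta(i)$. -}

module Defs where

open import Data.Nat using (ℕ)
open import Data.Product using (Σ; ∃; ∃-syntax; _×_; _,_)
open import Data.Sum using (_⊎_)
open import Data.List using (List; []; _∷_; _++_; reverse)
open import Data.List.Membership.Propositional using (_∈_)
open import Data.List.Relation.Unary.Any using (Any)
open import Data.Unit using (⊤)
open import Relation.Nullary using (¬_)
open import Relation.Binary.PropositionalEquality using (_≡_; _≢_)
open import Relation.Binary.Construct.Closure.ReflexiveTransitive using (Star)

Nom : Set
Nom = ℕ

data Form : Set where
  prop : ℕ → Form
  nom  : Nom → Form
  ¬f_  : Form → Form
  _∧f_ : Form → Form → Form
  ◇_   : Form → Form
  at_⟨_⟩ : Nom → Form → Form

□_ : Form → Form
□ φ = ¬f (◇ (¬f φ))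

noms : Form → List Nom
noms (prop p)    = []
noms (nom i)     = i ∷ []
noms (¬f φ)      = noms φ
noms (φ ∧f ψ)    = noms φ ++ noms ψ
noms (◇ φ)       = noms φ
noms (at i ⟨ φ ⟩) = i ∷ noms φ

data Sub : Form → Form → Set where
  refl  : ∀ {φ} → Sub φ φ
  ¬s    : ∀ {φ ψ} → Sub φ ψ → Sub φ (¬f ψ)
  ∧l    : ∀ {φ ψ χ} → Sub φ ψ → Sub φ (ψ ∧f χ)
  ∧r    : ∀ {φ ψ χ} → Sub φ χ → Sub φ (ψ ∧f χ)
  ◇s    : ∀ {φ ψ} → Sub φ ψ → Sub φ (◇ ψ)
  ats    : ∀ {φ ψ i} → Sub φ ψ → Sub φ (at i ⟨ ψ ⟩)

-- Tableau formulas  @_i φ  are represented as pairs (i , φ).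

Entry : Set
Entry = Nom × Form

nomsE : Entry → List Nom
nomsE (i , φ) = i ∷ noms φ

-- One extension step of a branch.
--   dia i φ j : rule [◇] applied to @_i ◇φ, introducing the new nominal j;
--               it adds @_i ◇ j and @_j φ.
--   plain es  : any other rule, adding the formulas es.
data Step : Set where
  dia   : Nom → Form → Nom → Step
  plain : List Entry → Step

added : Step → List Entry
added (dia i φ j) = (i , ◇ (nom j)) ∷ (j , φ) ∷ []
added (plain es)  = es

-- A branch (or an initial segment of one): the root formula @_{i0} φ0
-- together with the history of rule applications, NEWEST FIRST.
record Branch : Set where
  constructor mkBranch
  field
    root : Entry
    hist : List Step
open Branch public

rootForm : Branch → Form
rootForm Θ with root Θ
... | (_ , φ) = φ

_∈Θ_ : Entry → Branch → Set
e ∈Θ Θ = (e ≡ root Θ) ⊎ Any (λ s → e ∈ added s) (hist Θ)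

Occurs : Branch → Nom → Set
Occurs Θ n = Σ Entry λ e → e ∈Θ Θ × n ∈ nomsE e

Closed : Branch → Set
Closed Θ = Σ Nom λ i → Σ Form λ φ → ((i , φ) ∈Θ Θ) × ((i , ¬f φ) ∈Θ Θ)

Open : Branch → Set
Open Θ = ¬ Closed Θ

IsAcc : Branch → Entry → Set
IsAcc Θ (i , ψ) = Σ Form λ φ → Σ Nom λ j → (ψ ≡ ◇ (nom j)) × (dia i φ j ∈ hist Θ)

Used : Branch → Nom → Form → Set
Used Θ i φ = Σ Nom λ j → dia i φ j ∈ hist Θ

QSub : Form → Form → Set
QSub φ ψ = Sub φ ψ ⊎ (Σ Form λ χ → (φ ≡ ¬f χ) × Sub χ ψ)

InT : Branch → Nom → Form → Set
InT Θ i φ = ((i , φ) ∈Θ Θ) × QSub φ (rootForm Θ)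

Twins : Branch → Nom → Nom → Set
Twins Θ i j = ∀ φ → (InT Θ i φ → InT Θ j φ) × (InT Θ j φ → InT Θ i φ)

Prec : Branch → Nom → Nom → Set
Prec Θ i j = Σ Form λ φ → dia i φ j ∈ hist Θ

Prec* : Branch → Nom → Nom → Set
Prec* Θ = Star (Prec Θ)

QuasiUrfather : Branch → Nom → Set
QuasiUrfather Θ i =
  ¬ (Σ Nom λ j → Σ Nom λ k → (j ≢ k) × Twins Θ j k × Prec* Θ j i × Prec* Θ k i)

-- order of introduction of nominals: first those of the root formula
-- (i0, then left to right through φ0), then the nominals introduced by
-- [◇], in chronological order.
diaNews : List Step → List Nom
diaNews []                = []
diaNews (dia i φ j ∷ ss)  = j ∷ diaNews ss
diaNews (plain es ∷ ss)   = diaNews ss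

introList : Branch → List Nom
introList Θ = nomsE (root Θ) ++ reverse (diaNews (hist Θ))

data Before : List Nom → Nom → Nom → Set where
  here  : ∀ {j k xs} → j ≢ k → Before (j ∷ xs) j k
  there : ∀ {x j k xs} → x ≢ j → x ≢ k → Before xs j k → Before (x ∷ xs) j k

IsV : Branch → Nom → Nom → Set
IsV Θ i j =
  Occurs Θ i × Occurs Θ j × Twins Θ i j × QuasiUrfather Θ j ×
  (∀ k → Occurs Θ k → Twins Θ i k → QuasiUrfather Θ k → k ≢ j →
     Before (introList Θ) j k)

data Rule (Θ : Branch) : Step → Set where
  r¬¬  : ∀ {i φ} → (i , ¬f (¬f φ)) ∈Θ Θ → Rule Θ (plain ((i , φ) ∷ []))
  r∧   : ∀ {i φ ψ} → (i , φ ∧f ψ) ∈Θ Θ →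
         Rule Θ (plain ((i , φ) ∷ (i , ψ) ∷ []))
  -- [¬∧] splits; a branch continues with one of the two conclusions.
  -- The rule can only generate something new if neither is present.
  r¬∧l : ∀ {i φ ψ} → (i , ¬f (φ ∧f ψ)) ∈Θ Θ → ¬ ((i , ¬f ψ) ∈Θ Θ) →
         Rule Θ (plain ((i , ¬f φ) ∷ []))
  r¬∧r : ∀ {i φ ψ} → (i , ¬f (φ ∧f ψ)) ∈Θ Θ → ¬ ((i , ¬f φ) ∈Θ Θ) →
         Rule Θ (plain ((i , ¬f ψ) ∷ []))
  r◇   : ∀ {i φ j} → (i , ◇ φ) ∈Θ Θ → ¬ Occurs Θ j → ¬ Used Θ i φ →
         ¬ IsAcc Θ (i , ◇ φ) → QuasiUrfather Θ i → Rule Θ (dia i φ j)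
  r¬◇  : ∀ {i j φ} → (i , ¬f (◇ φ)) ∈Θ Θ → (i , ◇ (nom j)) ∈Θ Θ →
         Rule Θ (plain ((j , ¬f φ) ∷ []))
  rAt   : ∀ {i j φ} → (i , at j ⟨ φ ⟩) ∈Θ Θ → Rule Θ (plain ((j , φ) ∷ []))
  r¬At  : ∀ {i j φ} → (i , ¬f (at j ⟨ φ ⟩)) ∈Θ Θ →
         Rule Θ (plain ((j , ¬f φ) ∷ []))
  rId  : ∀ {i j φ} → (i , φ) ∈Θ Θ → (i , nom j) ∈Θ Θ → ¬ IsAcc Θ (i , φ) →
         Rule Θ (plain ((j , φ) ∷ []))
  rRef : ∀ {i} → Occurs Θ i → Rule Θ (plain ((i , nom i) ∷ []))
  r□sym : ∀ {i j φ} → (i , □ φ) ∈Θ Θ → (j , ◇ (nom i)) ∈Θ Θ →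
          Rule Θ (plain ((j , φ) ∷ []))
  rI   : ∀ {i} → Occurs Θ i → Rule Θ (plain ((i , ¬f (◇ (nom i))) ∷ []))

NewStep : Branch → Step → Set
NewStep Θ (dia i φ j) = ⊤
NewStep Θ (plain es)  = Any (λ e → ¬ (e ∈Θ Θ)) es

Saturated : Branch → Set
Saturated Θ = ∀ s → Rule Θ s → ¬ NewStep Θ s

RootOK : Entry → Set
RootOK (i , φ) = ¬ (i ∈ noms φ)

data Legal (r : Entry) : List Step → Set where
  start  : RootOK r → Legal r []
  extend : ∀ {s ss} → Legal r ss → Open (mkBranch r ss) →
           Rule (mkBranch r ss) s → NewStep (mkBranch r ss) s →
           Legal r (s ∷ ss)

IsTableauBranch : Branch → Set
IsTableauBranch Θ = Legal (root Θ) (hist Θ)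

InW : Branch → Nom → Set
InW Θ w = IsV Θ w w

RΘ : Branch → Nom → Nom → Set
RΘ Θ a b = Σ Nom λ i → Σ Nom λ j → ((i , ◇ (nom j)) ∈Θ Θ) ×
  ((IsV Θ i a × IsV Θ j b) ⊎ (IsV Θ j a × IsV Θ i b))

NamedByRoot : Branch → Nom → Set
NamedByRoot Θ w = Σ Nom λ j → InT Θ w (nom j)

{-# OPTIONS --safe #-}
module Submission where

open import Defs
open import Data.Empty using (⊥)
open import Data.List using ([]; _∷_)
open import Data.List.Relation.Unary.Any using (here; there)
open import Data.Product using (Σ; _×_; _,_; proj₁; proj₂)
open import Data.Sum using (inj₁; inj₂)
open import Effect.Monad using (RawMonad)
open import Level using (0ℓ)
open import Relation.Binary.PropositionalEquality using (refl)
open import Relation.Nullary using (¬_)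
open import Relation.Nullary.Negation using (¬¬-Monad)

-- A loop w R w comes from a formula @_i ◇ j on the branch with i and j both
-- twins of w.  If w were named by a nominal k, then @_i k and @_j k would be on
-- the branch, so Ref and Id would identify i with j, giving @_j i.  The
-- irreflexivity rule I puts @_j ¬◇ j on the branch, Id moves it to @_i ¬◇ j,
-- and the branch is closed.

open RawMonad (¬¬-Monad {a = 0ℓ})

occurs-at : ∀ {Θ i φ} → (i , φ) ∈Θ Θ → Occurs Θ i
occurs-at {i = i} {φ} i∶φ = (i , φ) , i∶φ , here refl

occurs-◇ : ∀ {Θ i j} → (i , ◇ nom j) ∈Θ Θ → Occurs Θ j
occurs-◇ {i = i} {j} i∶◇j = (i , ◇ nom j) , i∶◇j , there (here refl)

nom-¬IsAcc : ∀ {Θ i k} → ¬ IsAcc Θ (i , nom k)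
nom-¬IsAcc (_ , _ , () , _)

¬f-¬IsAcc : ∀ {Θ i φ} → ¬ IsAcc Θ (i , ¬f φ)
¬f-¬IsAcc (_ , _ , () , _)

IsV⇒Twins : ∀ {Θ i j} → IsV Θ i j → Twins Θ i j
IsV⇒Twins (_ , _ , twins , _) = twins

RΘ-loop : ∀ {Θ w} → RΘ Θ w w →
          Σ Nom λ i → Σ Nom λ j →
            ((i , ◇ nom j) ∈Θ Θ) × Twins Θ i w × Twins Θ j w
RΘ-loop (i , j , i∶◇j , inj₁ (vi , vj)) = i , j , i∶◇j , IsV⇒Twins vi , IsV⇒Twins vj
RΘ-loop (i , j , i∶◇j , inj₂ (vj , vi)) = i , j , i∶◇j , IsV⇒Twins vi , IsV⇒Twins vj

twin-named : ∀ {Θ i w k} → Twins Θ i w → InT Θ w (nom k) → (i , nom k) ∈Θ Θ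
twin-named {k = k} twins w∶k = proj₁ (proj₂ (twins (nom k)) w∶k)

module _ {Θ : Branch} (sat : Saturated Θ) where

  -- Membership in a branch is not decided, so saturation only yields it up to
  -- double negation; this suffices since the final goal is ⊥.
  derive : ∀ {e} → Rule Θ (plain (e ∷ [])) → ¬ ¬ (e ∈Θ Θ)
  derive rule e∉Θ = sat _ rule (here e∉Θ)

  nom-swap : ∀ {i k} → (i , nom k) ∈Θ Θ → ¬ ¬ ((k , nom i) ∈Θ Θ)
  nom-swap i∶k = do
    i∶i ← derive (rRef (occurs-at i∶k))
    derive (rId i∶i i∶k (nom-¬IsAcc {Θ}))

  co-named⇒equal : ∀ {i j k} → (i , nom k) ∈Θ Θ → (j , nom k) ∈Θ Θ →
                   ¬ ¬ ((j , nom i) ∈Θ Θ)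
  co-named⇒equal i∶k j∶k = do
    k∶i ← nom-swap i∶k
    k∶j ← nom-swap j∶k
    derive (rId k∶i k∶j (nom-¬IsAcc {Θ}))

  equal⇒¬◇ : ∀ {i j} → Occurs Θ j → (j , nom i) ∈Θ Θ →
             ¬ ¬ ((i , ¬f (◇ nom j)) ∈Θ Θ)
  equal⇒¬◇ occ-j j∶i = do
    j∶¬◇j ← derive (rI occ-j)
    derive (rId j∶¬◇j j∶i (¬f-¬IsAcc {Θ}))

  co-named-◇-closes : Open Θ → ∀ {i j k} → (i , ◇ nom j) ∈Θ Θ →
                      (i , nom k) ∈Θ Θ → (j , nom k) ∈Θ Θ → ⊥
  co-named-◇-closes open-Θ {i} {j} i∶◇j i∶k j∶k = closes λ i∶¬◇j →
    open-Θ (i , ◇ nom j , i∶◇j , i∶¬◇j)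
    where
    closes : ¬ ¬ ((i , ¬f (◇ nom j)) ∈Θ Θ)
    closes = co-named⇒equal i∶k j∶k >>= equal⇒¬◇ (occurs-◇ i∶◇j)

lemma11 : (Θ : Branch) → IsTableauBranch Θ → Open Θ → Saturated Θ →
    (w : Nom) → InW Θ w → RΘ Θ w w → ¬ NamedByRoot Θ w
lemma11 Θ _ open-Θ sat w _ wRw (k , w∶k)
  with i , j , i∶◇j , i≈w , j≈w ← RΘ-loop wRw
  = co-named-◇-closes sat open-Θ i∶◇j (twin-named i≈w w∶k) (twin-named j≈w w∶k)
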